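{- Let $(L,\leq)$ be a finite lower locally distributive lattice, $f:L\to\mathbb{R}$, and let $m:L\to\mathbb{R}$ be the Möbius transform of $f$, i.e. the unique function with $f(x)=\sum_{y\leq x}m(y)$ for all $x\in L$. Let $x,y\in L$ be such that the derivative $\Delta_y f(x)$ is Boolean. Then \[\Delta_y f(x)=\sum_{z\in[y,x\vee y]}m(z).\]
   Context: A finite lattice is lower locally distributive if it is lower semi-modular (for all $x,y$, if $x\vee y$ covers both $x$ and $y$ then $x$ and $y$ both cover $x\wedge y$) and contains no sublattice isomorphic to $M_3$. $\mathcal{J}(L)$ denotes the set of join-irreducible elements (non-bottom elements covering exactly one element). In such a lattice every $y$ has a unique decomposition $y=\bigvee\eta^*(y)$ into join-irreducible elements of minimal cardinality (minimal decomposition $\eta^*(y)$). For $i\in\mathcal{J}(L)$, $\Delta_i f(x):=f(x\vee i)-f(x)$. If $\eta^*(y)=\{i_1,\ldots,i_k\}$, $\Delta_y f(x):=\Delta_{i_1}(\Delta_{i_2}(\cdots\Delta_{i_k}f(x)\cdots))$. This derivative is called Boolean if the interval $[x,x\vee y]$ is isomorphic to the Boolean lattice $2^k$, $k=|\eta^*(y)|$. -}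

module Defs where

open import Level using (Level; _⊔_)
open import Data.Nat using (ℕ; _≤_)
open import Data.Bool using (_∧_)
open import Data.Product using (Σ; ∃; _×_)
open import Data.List using (List; []; _∷_; length; foldr; filter; map)
open import Data.List.Membership.Propositional using (_∈_)
open import Data.List.Relation.Unary.All using (All)
open import Data.List.Relation.Unary.Unique.Propositional using (Unique)
open import Data.Fin.Subset using (Subset; _⊆_)
open import Relation.Nullary using (¬_; Dec)
open import Relation.Nullary.Decidable using (_×-dec_)
open import Relation.Unary using (Pred)
open import Relation.Binary using (Rel; Decidable; Minimum)
open import Relation.Binary.PropositionalEquality using (_≡_; _≢_)
open import Relation.Binary.Lattice.Structures using (IsLattice)
open import Algebra.Bundles using (AbelianGroup)

record FiniteLattice : Set₁ where
  infixr 6 _∨_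
  infixr 7 _∧ₗ_
  infix 4 _≼_
  field
    Carrier   : Set
    _≼_       : Rel Carrier _
    _∨_       : Carrier → Carrier → Carrier
    _∧ₗ_      : Carrier → Carrier → Carrier
    isLattice : IsLattice _≡_ _≼_ _∨_ _∧ₗ_
    _≼?_      : Decidable _≼_
    ⊥ₗ        : Carrier
    minimum   : Minimum _≼_ ⊥ₗ
    elems     : List Carrier
    complete  : ∀ x → x ∈ elems
    unique    : Unique elems

module _ (L : FiniteLattice) where
  open FiniteLattice L

  _≺_ : Rel Carrier _
  a ≺ b = a ≼ b × a ≢ b

  _⋖_ : Rel Carrier _
  a ⋖ b = a ≺ b × (∀ c → a ≺ c → ¬ (c ≺ b))

  LowerSemimodular : Set
  LowerSemimodular = ∀ x y → x ⋖ (x ∨ y) → y ⋖ (x ∨ y) →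
                     (x ∧ₗ y) ⋖ x × (x ∧ₗ y) ⋖ y

  -- L has a sublattice isomorphic to M₃: elements o, a, b, c, t with a, b, c
  -- pairwise distinct, pairwise meets o and pairwise joins t
  -- (this forces o, t to be distinct from a, b, c and from each other).
  HasM3 : Set
  HasM3 = Σ Carrier λ o → Σ Carrier λ a → Σ Carrier λ b → Σ Carrier λ c →
          Σ Carrier λ t →
          a ≢ b × a ≢ c × b ≢ c ×
          (a ∧ₗ b ≡ o) × (a ∧ₗ c ≡ o) × (b ∧ₗ c ≡ o) ×
          (a ∨ b ≡ t) × (a ∨ c ≡ t) × (b ∨ c ≡ t)

  LowerLocallyDistributive : Set
  LowerLocallyDistributive = LowerSemimodular × ¬ HasM3

  JoinIrreducible : Carrier → Set
  JoinIrreducible i = i ≢ ⊥ₗ × Σ Carrier λ j → j ⋖ i × (∀ k → k ⋖ i → k ≡ j)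

  ⋁ : List Carrier → Carrier
  ⋁ = foldr _∨_ ⊥ₗ

  MinimalDecomposition : Carrier → List Carrier → Set
  MinimalDecomposition y is =
    All JoinIrreducible is × Unique is × ⋁ is ≡ y ×
    (∀ js → All JoinIrreducible js → ⋁ js ≡ y → length is ≤ length js)

  IntervalBoolean : Carrier → Carrier → ℕ → Set
  IntervalBoolean a b k =
    Σ (Subset k → Carrier) λ φ →
      (∀ s → a ≼ φ s × φ s ≼ b) ×
      (∀ z → a ≼ z → z ≼ b → ∃ λ s → φ s ≡ z) ×
      (∀ s t → (s ⊆ t → φ s ≼ φ t) × (φ s ≼ φ t → s ⊆ t))

  module _ {c ℓ : Level} (G : AbelianGroup c ℓ) where
    open AbelianGroup G renaming (Carrier to V; _∙_ to _+_; ε to 0#; _⁻¹ to -_)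

    sumL : (Carrier → V) → List Carrier → V
    sumL g = foldr (λ z acc → g z + acc) 0#

    sumBelow : (Carrier → V) → Carrier → V
    sumBelow m x = sumL m (filter (λ y → y ≼? x) elems)

    sumInterval : (Carrier → V) → Carrier → Carrier → V
    sumInterval m a b =
      sumL m (filter (λ z → (a ≼? z) ×-dec (z ≼? b)) elems)

    IsMoebius : (Carrier → V) → (Carrier → V) → Set ℓ
    IsMoebius f m = ∀ x → f x ≈ sumBelow m x

    Δ₁ : Carrier → (Carrier → V) → Carrier → V
    Δ₁ i f x = f (x ∨ i) + (- f x)

    Δ : List Carrier → (Carrier → V) → Carrier → V
    Δ []       f = f
    Δ (i ∷ is) f = Δ₁ i (Δ is f)

-- Lower local distributivity gives: a join-irreducible i below v lies under all but at most
-- one lower cover of v; hence, if x ⋖ t and i ≤ t, i ≰ x, every z ≤ t with z ≰ x is above i.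
-- In the Boolean interval [x, x ∨ y] joining a join-irreducible raises the rank by at most one,
-- and x ∨ ⋁ η*(y) lies |η*(y)| ranks above x, so every partial join is a cover:
-- X ⋖ X ∨ i for X = w ∨ ⋁ is.  Induction on the decomposition then writes
-- Δ_{i ∷ is} f w = Δ_is f (w ∨ i) − Δ_is f w as the sum of m over [⋁ is, X ∨ i] minus the sum
-- over [⋁ is, X], and the covering fact says that the difference is [i ∨ ⋁ is, X ∨ i].

module Submission where

open import Defs hiding (_≺_; _⋖_)
import Defs
open import Level using (Level)
open import Data.Nat as ℕ using (ℕ; suc; _≤_; _<_; z≤n; s≤s)
import Data.Nat.Properties as ℕ
open import Data.Nat.Induction using (<-wellFounded)
open import Data.Product using (∃; ∃₂; _×_; _,_; proj₁; proj₂; uncurry)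
open import Data.Sum using (_⊎_; inj₁; inj₂; [_,_])
open import Data.Empty using (⊥; ⊥-elim)
open import Data.List using (List; []; _∷_; length; filter)
open import Data.List.Properties using (filter-≐)
open import Data.List.Relation.Unary.All using (All; []; _∷_)
open import Data.List.Relation.Unary.Any using (here; there)
open import Data.List.Membership.Propositional using (_∈_; lose)
import Data.List.Relation.Unary.Any as Any
open import Data.Vec using ([]; _∷_; here; there)
open import Data.Fin using (Fin)
open import Data.Fin.Properties using (any?) renaming (_≟_ to _≟ᶠ_)
open import Data.Fin.Subset as Subset using (Subset; inside; outside; _-_; ∣_∣; _⊆_)
open import Data.Fin.Subset.Properties
  using (_∈?_; ⊆-antisym; p─q⊆p; p─⊥≡p; x∈p∧x≢y⇒x∈p-y; ⊥⊆; ⊆⊤; ∣⊥∣≡0; ∣⊤∣≡n)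
open import Function using (flip; _∘_)
open import Induction.WellFounded using (WellFounded; Acc; acc; module Subrelation)
import Relation.Binary.Construct.On as On
open import Relation.Nullary using (¬_; Dec; yes; no; ¬?)
open import Relation.Nullary.Decidable using (_×-dec_; decidable-stable)
open import Relation.Unary as U using (Pred; _≐_; _∪_; _∩_)
open import Relation.Binary.PropositionalEquality
  using (_≡_; _≢_; refl; sym; trans; cong; subst; subst₂)
open import Relation.Binary using (Rel)
open import Relation.Binary.Lattice.Bundles using (Lattice)
import Relation.Binary.Properties.Poset as PosetProperties
open import Algebra.Bundles using (AbelianGroup; CommutativeSemigroup)
open import Algebra.Structures using (IsCommutativeBand)
import Algebra.Properties.CommutativeSemigroup as CommutativeSemigroupProperties
import Algebra.Properties.Group as GroupProperties
import Relation.Binary.Lattice.Properties.JoinSemilattice as JoinSemilatticeProperties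
import Relation.Binary.Reasoning.Setoid as SetoidReasoning

module _ {a p q} {A : Set a} {P : Pred A p} {Q : Pred A q}
         (P? : U.Decidable P) (Q? : U.Decidable Q) (P⊆Q : P U.⊆ Q) where

  length-filter-mono : ∀ xs → length (filter P? xs) ≤ length (filter Q? xs)
  length-filter-mono []       = z≤n
  length-filter-mono (x ∷ xs) with P? x | Q? x
  ... | yes _  | yes _  = s≤s (length-filter-mono xs)
  ... | yes px | no ¬qx = ⊥-elim (¬qx (P⊆Q px))
  ... | no _   | yes _  = ℕ.m≤n⇒m≤1+n (length-filter-mono xs)
  ... | no _   | no _   = length-filter-mono xs

  length-filter-< : ∀ {x xs} → x ∈ xs → Q x → ¬ P x →
                    length (filter P? xs) < length (filter Q? xs)
  length-filter-< {xs = y ∷ xs} (here refl) qx ¬px with P? y | Q? y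
  ... | yes px | _      = ⊥-elim (¬px px)
  ... | no _   | yes _  = s≤s (length-filter-mono xs)
  ... | no _   | no ¬qx = ⊥-elim (¬qx qx)
  length-filter-< {xs = y ∷ xs} (there x∈xs) qx ¬px with P? y | Q? y
  ... | yes _  | yes _  = s≤s (length-filter-< x∈xs qx ¬px)
  ... | yes py | no ¬qy = ⊥-elim (¬qy (P⊆Q py))
  ... | no _   | yes _  = ℕ.m≤n⇒m≤1+n (length-filter-< x∈xs qx ¬px)
  ... | no _   | no _   = length-filter-< x∈xs qx ¬px

x∉p-x : ∀ {n} {x : Fin n} (p : Subset n) → x Subset.∉ p - x
x∉p-x {x = Fin.zero}  (_ ∷ p) ()
x∉p-x {x = Fin.suc x} (_ ∷ p) (there x∈p-x) = x∉p-x p x∈p-x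

∣p∣≡1+∣p-x∣ : ∀ {n} {x : Fin n} {p : Subset n} → x Subset.∈ p → ∣ p ∣ ≡ suc ∣ p - x ∣
∣p∣≡1+∣p-x∣ {p = inside ∷ p}  here = cong suc (cong ∣_∣ (sym (p─⊥≡p p)))
∣p∣≡1+∣p-x∣ {p = inside ∷ p}  (there x∈p) = cong suc (∣p∣≡1+∣p-x∣ x∈p)
∣p∣≡1+∣p-x∣ {p = outside ∷ p} (there x∈p) = ∣p∣≡1+∣p-x∣ x∈p

⊆-or-∃∉ : ∀ {n} (p q : Subset n) → p ⊆ q ⊎ ∃ λ j → j Subset.∈ p × j Subset.∉ q
⊆-or-∃∉ p q with any? (λ j → (j ∈? p) ×-dec ¬? (j ∈? q))
... | yes witness = inj₂ witness
... | no ∄ = inj₁ λ {j} j∈p → decidable-stable (j ∈? q) (λ j∉q → ∄ (j , j∈p , j∉q))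

module FiniteLatticeProperties (L : FiniteLattice) where
  open FiniteLattice L

  infix 4 _≺_ _⋖_
  _≺_ _⋖_ : Rel Carrier _
  _≺_ = Defs._≺_ L
  _⋖_ = Defs._⋖_ L

  lattice : Lattice _ _ _
  lattice = record { isLattice = isLattice }

  open Lattice lattice public
    using (x≤x∨y; y≤x∨y; ∨-least; x∧y≤x; x∧y≤y; ∧-greatest)
    renaming (refl to ≼-refl; trans to ≼-trans; antisym to ≼-antisym)
  open PosetProperties (Lattice.poset lattice) public
    using (<⇒≱; ≤∧≉⇒<) renaming (≤-dec⇒≈-dec to ≼-dec⇒≡-dec)

  _≟_ : (a b : Carrier) → Dec (a ≡ b)
  _≟_ = ≼-dec⇒≡-dec _≼?_

  _≺?_ : (a b : Carrier) → Dec (a ≺ b)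
  a ≺? b = (a ≼? b) ×-dec ¬? (a ≟ b)

  ≺-wellFounded : WellFounded _≺_
  ≺-wellFounded = Subrelation.wellFounded ≺⇒< (On.wellFounded downsetSize <-wellFounded)
    where
    downsetSize : Carrier → ℕ
    downsetSize v = length (filter (_≼? v) elems)
    ≺⇒< : ∀ {u v} → u ≺ v → downsetSize u < downsetSize v
    ≺⇒< u≺v@(u≼v , _) = length-filter-< (_≼? _) (_≼? _) (λ z≼u → ≼-trans z≼u u≼v)
                          (complete _) ≼-refl (<⇒≱ u≺v)

  ≻-wellFounded : WellFounded (flip _≺_)
  ≻-wellFounded = Subrelation.wellFounded ≺⇒> (On.wellFounded upsetSize <-wellFounded)
    where
    upsetSize : Carrier → ℕ
    upsetSize u = length (filter (u ≼?_) elems)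
    ≺⇒> : ∀ {v u} → u ≺ v → upsetSize v < upsetSize u
    ≺⇒> u≺v@(u≼v , _) = length-filter-< (_ ≼?_) (_ ≼?_) (≼-trans u≼v)
                          (complete _) ≼-refl (<⇒≱ u≺v)

  lowerCover-above : ∀ {u v} → u ≺ v → ∃ λ t → u ≼ t × t ⋖ v
  lowerCover-above = go (≻-wellFounded _)
    where
    go : ∀ {u v} → Acc (flip _≺_) u → u ≺ v → ∃ λ t → u ≼ t × t ⋖ v
    go {u} {v} (acc rs) u≺v with Any.any? (λ c → (u ≺? c) ×-dec (c ≺? v)) elems
    ... | no ∄ = u , ≼-refl , u≺v , λ c u≺c c≺v → ∄ (lose (complete c) (u≺c , c≺v))
    ... | yes c∈ with Any.satisfied c∈
    ...   | c , u≺c , c≺v with go (rs u≺c) c≺v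
    ...     | t , c≼t , t⋖v = t , ≼-trans (proj₁ u≺c) c≼t , t⋖v

  ⋖-between : ∀ {a b c} → a ⋖ b → a ≼ c → c ≺ b → a ≡ c
  ⋖-between {a} {c = c} (_ , a-cover) a≼c c≺b =
    decidable-stable (a ≟ c) λ a≢c → a-cover c (≤∧≉⇒< a≼c a≢c) c≺b

  lowerCovers-join : ∀ {c₁ c₂ v} → c₁ ⋖ v → c₂ ⋖ v → c₁ ≢ c₂ → c₁ ∨ c₂ ≡ v
  lowerCovers-join {c₁} {c₂} {v} c₁⋖v c₂⋖v c₁≢c₂ =
    decidable-stable ((c₁ ∨ c₂) ≟ v) λ c₁∨c₂≢v →
      let c₁∨c₂≺v = ≤∧≉⇒< (∨-least (proj₁ (proj₁ c₁⋖v)) (proj₁ (proj₁ c₂⋖v))) c₁∨c₂≢v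
      in  c₁≢c₂ (trans (⋖-between c₁⋖v (x≤x∨y c₁ c₂) c₁∨c₂≺v)
                       (sym (⋖-between c₂⋖v (y≤x∨y c₁ c₂) c₁∨c₂≺v)))

  ∨-identityʳ : ∀ w → w ∨ ⊥ₗ ≡ w
  ∨-identityʳ w = ≼-antisym (∨-least ≼-refl (minimum w)) (x≤x∨y w ⊥ₗ)

  ∨-commutativeSemigroup : CommutativeSemigroup _ _
  ∨-commutativeSemigroup = record
    { isCommutativeSemigroup = IsCommutativeBand.isCommutativeSemigroup
        (JoinSemilatticeProperties.isAlgSemilattice (Lattice.joinSemilattice lattice)) }

  module ∨ = CommutativeSemigroupProperties ∨-commutativeSemigroup
  open CommutativeSemigroup ∨-commutativeSemigroup using () renaming (assoc to ∨-assoc)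

  module _ {c ℓ} (G : AbelianGroup c ℓ) where
    open AbelianGroup G using (_≈_; _∙_; ε; ∙-congˡ; assoc; identityˡ; commutativeSemigroup)
      renaming (sym to ≈-sym; trans to ≈-trans)
    open CommutativeSemigroupProperties commutativeSemigroup using (x∙yz≈y∙xz)

    sumL-filter-split : ∀ {p} {P Q R : Pred Carrier p}
                        (P? : U.Decidable P) (Q? : U.Decidable Q) (R? : U.Decidable R) →
                        P ≐ Q ∪ R → U.Empty (Q ∩ R) → ∀ g zs →
                        sumL L G g (filter P? zs) ≈ sumL L G g (filter Q? zs) ∙ sumL L G g (filter R? zs)
    sumL-filter-split P? Q? R? P≐Q∪R Q∩R=∅ g [] = ≈-sym (identityˡ ε)
    sumL-filter-split P? Q? R? P≐Q∪R Q∩R=∅ g (z ∷ zs)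
      with ih ← sumL-filter-split P? Q? R? P≐Q∪R Q∩R=∅ g zs | P? z | Q? z | R? z
    ... | yes _  | yes qz | yes rz = ⊥-elim (Q∩R=∅ z (qz , rz))
    ... | yes _  | yes _  | no _   = ≈-trans (∙-congˡ ih) (≈-sym (assoc _ _ _))
    ... | yes _  | no _   | yes _  = ≈-trans (∙-congˡ ih) (x∙yz≈y∙xz _ _ _)
    ... | yes pz | no ¬qz | no ¬rz = ⊥-elim ([ ¬qz , ¬rz ] (proj₁ P≐Q∪R pz))
    ... | no ¬pz | yes qz | _      = ⊥-elim (¬pz (proj₂ P≐Q∪R (inj₁ qz)))
    ... | no ¬pz | no _   | yes rz = ⊥-elim (¬pz (proj₂ P≐Q∪R (inj₂ rz)))
    ... | no _   | no _   | no _   = ih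

  module BooleanInterval {a b k} (B : IntervalBoolean L a b k) where

    φ : Subset k → Carrier
    φ = proj₁ B

    φ-bounds : ∀ s → a ≼ φ s × φ s ≼ b
    φ-bounds = proj₁ (proj₂ B)

    φ-surjective : ∀ z → a ≼ z → z ≼ b → ∃ λ s → φ s ≡ z
    φ-surjective = proj₁ (proj₂ (proj₂ B))

    φ-monotone : ∀ {s t} → s ⊆ t → φ s ≼ φ t
    φ-monotone {s} {t} = proj₁ (proj₂ (proj₂ (proj₂ B)) s t)

    φ-reflects : ∀ {s t} → φ s ≼ φ t → s ⊆ t
    φ-reflects {s} {t} = proj₂ (proj₂ (proj₂ (proj₂ B)) s t)

    φ-injective : ∀ {s t} → φ s ≡ φ t → s ≡ t
    φ-injective {s} φs≡φt = ⊆-antisym (φ-reflects (subst (φ s ≼_) φs≡φt ≼-refl))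
                                      (φ-reflects (subst (_≼ φ s) φs≡φt ≼-refl))

    φ-surjective-between : ∀ {s t z} → φ s ≼ z → z ≼ φ t → ∃ λ u → φ u ≡ z
    φ-surjective-between {s} {t} φs≼z z≼φt =
      φ-surjective _ (≼-trans (proj₁ (φ-bounds s)) φs≼z) (≼-trans z≼φt (proj₂ (φ-bounds t)))

    a≼b : a ≼ b
    a≼b = uncurry ≼-trans (φ-bounds Subset.⊥)

    φ-⊥ : φ Subset.⊥ ≡ a
    φ-⊥ with φ-surjective a ≼-refl a≼b
    ... | s , φs≡a = ≼-antisym (subst (φ Subset.⊥ ≼_) φs≡a (φ-monotone ⊥⊆)) (proj₁ (φ-bounds Subset.⊥))

    φ-⊤ : φ Subset.⊤ ≡ b
    φ-⊤ with φ-surjective b a≼b ≼-refl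
    ... | s , φs≡b = ≼-antisym (proj₂ (φ-bounds Subset.⊤)) (subst (_≼ φ Subset.⊤) φs≡b (φ-monotone ⊆⊤))

    φ-lowerCover : ∀ {t j} → j Subset.∈ t → φ (t - j) ⋖ φ t
    φ-lowerCover {t} {j} j∈t = (φ-monotone (p─q⊆p t _) , t-j≢t ∘ φ-injective) , nothing-between
      where
      t-j≢t : t - j ≢ t
      t-j≢t t-j≡t = x∉p-x t (subst (j Subset.∈_) (sym t-j≡t) j∈t)
      nothing-between : ∀ c → φ (t - j) ≺ c → ¬ c ≺ φ t
      nothing-between c (t-j≼c , t-j≢c) (c≼t , c≢t) with φ-surjective-between t-j≼c c≼t
      ... | u , refl with j ∈? u
      ...   | yes j∈u = c≢t (cong φ (⊆-antisym (φ-reflects c≼t) t⊆u))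
        where
        t⊆u : t ⊆ u
        t⊆u {l} l∈t with l ≟ᶠ j
        ... | yes refl = j∈u
        ... | no l≢j   = φ-reflects t-j≼c (x∈p∧x≢y⇒x∈p-y l∈t l≢j)
      ...   | no j∉u = t-j≢c (cong φ (⊆-antisym (φ-reflects t-j≼c) u⊆t-j))
        where
        u⊆t-j : u ⊆ t - j
        u⊆t-j l∈u = x∈p∧x≢y⇒x∈p-y (φ-reflects c≼t l∈u) λ { refl → j∉u l∈u }

  module LowerLocallyDistributiveProperties (lld : LowerLocallyDistributive L) where

    lowerCovers-meet-⋖ : ∀ {c₁ c₂ v} → c₁ ⋖ v → c₂ ⋖ v → c₁ ≢ c₂ →
                         c₁ ∧ₗ c₂ ⋖ c₁ × c₁ ∧ₗ c₂ ⋖ c₂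
    lowerCovers-meet-⋖ c₁⋖v c₂⋖v c₁≢c₂ with lowerCovers-join c₁⋖v c₂⋖v c₁≢c₂
    ... | refl = proj₁ lld _ _ c₁⋖v c₂⋖v

    joinIrreducible-below-lowerCover : ∀ {c₁ c₂ v u} → c₁ ⋖ v → c₂ ⋖ v → c₁ ≢ c₂ →
                                       JoinIrreducible L u → u ≼ v → ¬ u ≼ c₁ → u ≼ c₂
    joinIrreducible-below-lowerCover c₁⋖v c₂⋖v c₁≢c₂ ju u≼v u⋠c₁ =
      decidable-stable (_ ≼? _) (avoids (≺-wellFounded _) c₁⋖v c₂⋖v c₁≢c₂ ju u≼v u⋠c₁)
      where
      avoids : ∀ {v} → Acc _≺_ v → ∀ {c₁ c₂ u} → c₁ ⋖ v → c₂ ⋖ v → c₁ ≢ c₂ →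
               JoinIrreducible L u → u ≼ v → ¬ u ≼ c₁ → ¬ u ≼ c₂ → ⊥
      avoids {v} (acc rs) {c₁} {c₂} {u} c₁⋖v c₂⋖v c₁≢c₂ ju@(_ , _ , _ , unique) u≼v u⋠c₁ u⋠c₂
        with u ≟ v
      ... | yes refl = c₁≢c₂ (trans (unique c₁ c₁⋖v) (sym (unique c₂ c₂⋖v)))
      ... | no u≢v with lowerCover-above (≤∧≉⇒< u≼v u≢v)
      ...   | t , u≼t , t⋖v = descend ((c₁ ∧ₗ t) ≟ (c₂ ∧ₗ t))
        where
        c₁≢t : c₁ ≢ t
        c₁≢t refl = u⋠c₁ u≼t
        c₂≢t : c₂ ≢ t
        c₂≢t refl = u⋠c₂ u≼t
        descend : Dec (c₁ ∧ₗ t ≡ c₂ ∧ₗ t) → ⊥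
        descend (no c₁∧t≢c₂∧t) =
          avoids (rs (proj₁ t⋖v)) (proj₂ (lowerCovers-meet-⋖ c₁⋖v t⋖v c₁≢t))
            (proj₂ (lowerCovers-meet-⋖ c₂⋖v t⋖v c₂≢t)) c₁∧t≢c₂∧t ju u≼t
            (λ u≼c₁∧t → u⋠c₁ (≼-trans u≼c₁∧t (x∧y≤x c₁ t)))
            (λ u≼c₂∧t → u⋠c₂ (≼-trans u≼c₂∧t (x∧y≤x c₂ t)))
        -- c₁, c₂ and t are then three lower covers of v with a common pairwise meet: an M₃.
        descend (yes c₁∧t≡c₂∧t) = proj₂ lld
          ( c₁ ∧ₗ c₂ , c₁ , c₂ , t , v , c₁≢c₂ , c₁≢t , c₂≢t
          , refl , c₁∧t≡c₁∧c₂ , trans (sym c₁∧t≡c₂∧t) c₁∧t≡c₁∧c₂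
          , lowerCovers-join c₁⋖v c₂⋖v c₁≢c₂ , lowerCovers-join c₁⋖v t⋖v c₁≢t
          , lowerCovers-join c₂⋖v t⋖v c₂≢t )
          where
          c₁∧t≡c₁∧c₂ : c₁ ∧ₗ t ≡ c₁ ∧ₗ c₂
          c₁∧t≡c₁∧c₂ =
            ⋖-between (proj₁ (lowerCovers-meet-⋖ c₁⋖v t⋖v c₁≢t))
              (∧-greatest (x∧y≤x c₁ t) (subst (_≼ c₂) (sym c₁∧t≡c₂∧t) (x∧y≤x c₂ t)))
              (proj₁ (proj₁ (lowerCovers-meet-⋖ c₁⋖v c₂⋖v c₁≢c₂)))

    outside-lowerCover⇒above-joinIrreducible :
      ∀ {x t i z} → x ⋖ t → JoinIrreducible L i → i ≼ t → ¬ i ≼ x →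
      z ≼ t → ¬ z ≼ x → i ≼ z
    outside-lowerCover⇒above-joinIrreducible = go (≺-wellFounded _)
      where
      go : ∀ {t} → Acc _≺_ t → ∀ {x i z} → x ⋖ t → JoinIrreducible L i → i ≼ t → ¬ i ≼ x →
           z ≼ t → ¬ z ≼ x → i ≼ z
      go {t} (acc rs) {x} {i} {z} x⋖t ji i≼t i⋠x z≼t z⋠x with z ≟ t
      ... | yes refl = i≼t
      ... | no z≢t with lowerCover-above (≤∧≉⇒< z≼t z≢t)
      ...   | t′ , z≼t′ , t′⋖t with x ≟ t′
      ...     | yes refl = ⊥-elim (z⋠x z≼t′)
      ...     | no x≢t′ =
                go (rs (proj₁ t′⋖t)) (proj₂ (lowerCovers-meet-⋖ x⋖t t′⋖t x≢t′)) ji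
                  (joinIrreducible-below-lowerCover x⋖t t′⋖t x≢t′ ji i≼t i⋠x)
                  (λ i≼x∧t′ → i⋠x (≼-trans i≼x∧t′ (x∧y≤x x t′))) z≼t′
                  (λ z≼x∧t′ → z⋠x (≼-trans z≼x∧t′ (x∧y≤x x t′)))

    sumInterval-split-cover :
      ∀ {c ℓ} (G : AbelianGroup c ℓ) m {x i y} → x ⋖ x ∨ i → JoinIrreducible L i →
      AbelianGroup._≈_ G (sumInterval L G m y (x ∨ i))
        (AbelianGroup._∙_ G (sumInterval L G m (i ∨ y) (x ∨ i)) (sumInterval L G m y x))
    sumInterval-split-cover G m {x} {i} {y} x⋖x∨i ji =
      sumL-filter-split G (λ z → (y ≼? z) ×-dec (z ≼? (x ∨ i)))
        (λ z → ((i ∨ y) ≼? z) ×-dec (z ≼? (x ∨ i))) (λ z → (y ≼? z) ×-dec (z ≼? x))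
        (split , merge) disjoint m elems
      where
      i⋠x : ¬ i ≼ x
      i⋠x i≼x = <⇒≱ (proj₁ x⋖x∨i) (∨-least ≼-refl i≼x)
      split : ∀ {z} → y ≼ z × z ≼ x ∨ i → (i ∨ y ≼ z × z ≼ x ∨ i) ⊎ (y ≼ z × z ≼ x)
      split {z} (y≼z , z≼x∨i) with z ≼? x
      ... | yes z≼x = inj₂ (y≼z , z≼x)
      ... | no z⋠x  = inj₁ (∨-least i≼z y≼z , z≼x∨i)
        where
        i≼z : i ≼ z
        i≼z = outside-lowerCover⇒above-joinIrreducible x⋖x∨i ji (y≤x∨y x i) i⋠x z≼x∨i z⋠x
      merge : ∀ {z} → (i ∨ y ≼ z × z ≼ x ∨ i) ⊎ (y ≼ z × z ≼ x) → y ≼ z × z ≼ x ∨ i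
      merge (inj₁ (i∨y≼z , z≼x∨i)) = ≼-trans (y≤x∨y i y) i∨y≼z , z≼x∨i
      merge (inj₂ (y≼z , z≼x))     = y≼z , ≼-trans z≼x (x≤x∨y x i)
      disjoint : ∀ z → ¬ ((i ∨ y ≼ z × z ≼ x ∨ i) × (y ≼ z × z ≼ x))
      disjoint z ((i∨y≼z , _) , (_ , z≼x)) = i⋠x (≼-trans (≼-trans (x≤x∨y i y) i∨y≼z) z≼x)

    module _ {a b k} (B : IntervalBoolean L a b k) where
      open BooleanInterval B

      joinIrreducible-step : ∀ {s t i} → JoinIrreducible L i → φ t ≡ φ s ∨ i →
                             t ≡ s ⊎ (φ s ⋖ φ t × ∣ t ∣ ≡ suc ∣ s ∣)
      joinIrreducible-step {s} {t} {i} ji φt≡φs∨i = cases (⊆-or-∃∉ t s)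
        where
        s⊆t : s ⊆ t
        s⊆t = φ-reflects (subst (φ s ≼_) (sym φt≡φs∨i) (x≤x∨y (φ s) i))
        s⊆t-l : ∀ {l} → l Subset.∉ s → s ⊆ t - l
        s⊆t-l l∉s l′∈s = x∈p∧x≢y⇒x∈p-y (s⊆t l′∈s) λ { refl → l∉s l′∈s }
        i⋠φ[t-l] : ∀ {l} → l Subset.∈ t → l Subset.∉ s → ¬ i ≼ φ (t - l)
        i⋠φ[t-l] {l} l∈t l∉s i≼φ[t-l] = <⇒≱ (proj₁ (φ-lowerCover l∈t))
          (subst (_≼ φ (t - l)) (sym φt≡φs∨i) (∨-least (φ-monotone (s⊆t-l l∉s)) i≼φ[t-l]))
        cases : t ⊆ s ⊎ (∃ λ j → j Subset.∈ t × j Subset.∉ s) →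
                t ≡ s ⊎ (φ s ⋖ φ t × ∣ t ∣ ≡ suc ∣ s ∣)
        cases (inj₁ t⊆s) = inj₁ (⊆-antisym t⊆s s⊆t)
        cases (inj₂ (j , j∈t , j∉s)) with ⊆-or-∃∉ (t - j) s
        ... | inj₁ t-j⊆s = inj₂ ( subst (λ r → φ r ⋖ φ t) t-j≡s (φ-lowerCover j∈t)
                                , trans (∣p∣≡1+∣p-x∣ j∈t) (cong (suc ∘ ∣_∣) t-j≡s) )
          where
          t-j≡s : t - j ≡ s
          t-j≡s = ⊆-antisym t-j⊆s (s⊆t-l j∉s)
        ... | inj₂ (j′ , j′∈t-j , j′∉s) =
          ⊥-elim (i⋠φ[t-l] j′∈t j′∉s
            (joinIrreducible-below-lowerCover (φ-lowerCover j∈t) (φ-lowerCover j′∈t) φ[t-j]≢φ[t-j′] ji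
              (subst (i ≼_) (sym φt≡φs∨i) (y≤x∨y (φ s) i)) (i⋠φ[t-l] j∈t j∉s)))
          where
          j′∈t : j′ Subset.∈ t
          j′∈t = p─q⊆p t _ j′∈t-j
          φ[t-j]≢φ[t-j′] : φ (t - j) ≢ φ (t - j′)
          φ[t-j]≢φ[t-j′] φ[t-j]≡φ[t-j′] =
            x∉p-x t (subst (j′ Subset.∈_) (φ-injective φ[t-j]≡φ[t-j′]) j′∈t-j)

      rank-joinIrreducible-≤ : ∀ {s t i} → JoinIrreducible L i → φ t ≡ φ s ∨ i → ∣ t ∣ ≤ suc ∣ s ∣
      rank-joinIrreducible-≤ ji φt≡φs∨i with joinIrreducible-step ji φt≡φs∨i
      ... | inj₁ refl            = ℕ.n≤1+n _
      ... | inj₂ (_ , ∣t∣≡1+∣s∣) = ℕ.≤-reflexive ∣t∣≡1+∣s∣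

      φ-join-tail : ∀ {s t i y} → φ t ≡ φ s ∨ (i ∨ y) → ∃ λ u → φ u ≡ φ s ∨ y × φ t ≡ φ u ∨ i
      φ-join-tail {s} {t} {i} {y} φt≡φs∨[i∨y] =
        let u , φu≡φs∨y = φ-surjective-between (x≤x∨y (φ s) y)
                            (subst (φ s ∨ y ≼_) (sym φt≡[φs∨y]∨i) (x≤x∨y (φ s ∨ y) i))
        in  u , φu≡φs∨y , trans φt≡[φs∨y]∨i (cong (_∨ i) (sym φu≡φs∨y))
        where
        φt≡[φs∨y]∨i : φ t ≡ (φ s ∨ y) ∨ i
        φt≡[φs∨y]∨i = trans φt≡φs∨[i∨y] (∨.x∙yz≈xz∙y (φ s) i y)

      φ-join-head : ∀ {s t i y} → φ t ≡ φ s ∨ (i ∨ y) → ∃ λ u → φ u ≡ φ s ∨ i × φ t ≡ φ u ∨ y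
      φ-join-head {s} {t} {i} {y} φt≡φs∨[i∨y] =
        let u , φu≡φs∨i = φ-surjective-between (x≤x∨y (φ s) i)
                            (subst (φ s ∨ i ≼_) (sym φt≡[φs∨i]∨y) (x≤x∨y (φ s ∨ i) y))
        in  u , φu≡φs∨i , trans φt≡[φs∨i]∨y (cong (_∨ y) (sym φu≡φs∨i))
        where
        φt≡[φs∨i]∨y : φ t ≡ (φ s ∨ i) ∨ y
        φt≡[φs∨i]∨y = trans φt≡φs∨[i∨y] (sym (∨-assoc (φ s) i y))

      rank-⋁-≤ : ∀ {is s t} → All (JoinIrreducible L) is → φ t ≡ φ s ∨ ⋁ L is →
                 ∣ t ∣ ≤ length is ℕ.+ ∣ s ∣
      rank-⋁-≤ {[]} {s} [] φt≡φs∨⊥ =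
        ℕ.≤-reflexive (cong ∣_∣ (φ-injective (trans φt≡φs∨⊥ (∨-identityʳ (φ s)))))
      rank-⋁-≤ {i ∷ is} (ji ∷ jis) φt≡φs∨⋁ =
        let u , φu≡φs∨⋁is , φt≡φu∨i = φ-join-tail φt≡φs∨⋁
        in  ℕ.≤-trans (rank-joinIrreducible-≤ ji φt≡φu∨i) (s≤s (rank-⋁-≤ jis φu≡φs∨⋁is))

      -- Ranks in the Boolean interval are subset cardinalities; w ∨ ⋁ is lies length is ranks above w.
      Independent : Carrier → List Carrier → Set
      Independent w is = ∃₂ λ s t → φ s ≡ w × φ t ≡ w ∨ ⋁ L is × length is ℕ.+ ∣ s ∣ ≡ ∣ t ∣

      independent-∷ : ∀ {w i is} → All (JoinIrreducible L) (i ∷ is) → Independent w (i ∷ is) →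
                      Independent w is × w ∨ ⋁ L is ⋖ (w ∨ ⋁ L is) ∨ i
      independent-∷ {_} {i} {is} (ji ∷ jis) (s , t , refl , φt≡φs∨⋁ , 1+n+∣s∣≡∣t∣)
        with φ-join-tail φt≡φs∨⋁
      ... | u , φu≡φs∨⋁is , φt≡φu∨i with joinIrreducible-step ji φt≡φu∨i
      ...   | inj₁ refl =
                ⊥-elim (ℕ.≤⇒≯ (rank-⋁-≤ jis φu≡φs∨⋁is) (ℕ.≤-reflexive 1+n+∣s∣≡∣t∣))
      ...   | inj₂ (φu⋖φt , ∣t∣≡1+∣u∣) =
                ( (s , u , refl , φu≡φs∨⋁is , ℕ.suc-injective (trans 1+n+∣s∣≡∣t∣ ∣t∣≡1+∣u∣))
                , subst₂ _⋖_ φu≡φs∨⋁is (trans φt≡φu∨i (cong (_∨ i) φu≡φs∨⋁is)) φu⋖φt )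

      independent-shift : ∀ {w i is} → All (JoinIrreducible L) (i ∷ is) → Independent w (i ∷ is) →
                          Independent (w ∨ i) is
      independent-shift {_} {i} {is} (ji ∷ jis) (s , t , refl , φt≡φs∨⋁ , 1+n+∣s∣≡∣t∣) =
        let u , φu≡φs∨i , φt≡φu∨⋁is = φ-join-head φt≡φs∨⋁ in
        u , t , φu≡φs∨i , trans φt≡φu∨⋁is (cong (_∨ ⋁ L is) φu≡φs∨i) ,
        ℕ.≤-antisym (begin
          length is ℕ.+ ∣ u ∣        ≤⟨ ℕ.+-monoʳ-≤ (length is) (rank-joinIrreducible-≤ ji φu≡φs∨i) ⟩
          length is ℕ.+ suc ∣ s ∣    ≡⟨ ℕ.+-suc (length is) ∣ s ∣ ⟩
          suc (length is ℕ.+ ∣ s ∣)  ≡⟨ 1+n+∣s∣≡∣t∣ ⟩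
          ∣ t ∣                      ∎)
          (rank-⋁-≤ jis φt≡φu∨⋁is)
        where open ℕ.≤-Reasoning

      module _ {c ℓ} (G : AbelianGroup c ℓ) (f m : Carrier → AbelianGroup.Carrier G)
               (moebius : IsMoebius L G f m) where
        open AbelianGroup G using (_≈_; _∙_; ∙-congʳ; setoid; group) renaming (_-_ to _−_)
        open GroupProperties group using (//-cong₂; //-rightDividesʳ)
        open SetoidReasoning setoid

        Δ-independent : ∀ {is w} → All (JoinIrreducible L) is → Independent w is →
                        Δ L G is f w ≈ sumInterval L G m (⋁ L is) (w ∨ ⋁ L is)
        Δ-independent {[]} {w} [] _ = begin
          f w                            ≈⟨ moebius w ⟩
          sumBelow L G m w               ≡⟨ cong (sumL L G m) (filter-≐ _ _ below≐interval elems) ⟩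
          sumInterval L G m ⊥ₗ w         ≡⟨ cong (sumInterval L G m ⊥ₗ) (sym (∨-identityʳ w)) ⟩
          sumInterval L G m ⊥ₗ (w ∨ ⊥ₗ)  ∎
          where
          below≐interval : (_≼ w) ≐ (λ z → ⊥ₗ ≼ z × z ≼ w)
          below≐interval = (λ {z} z≼w → minimum z , z≼w) , proj₂
        Δ-independent {i ∷ is} {w} jis@(ji ∷ jis′) independent = begin
          Δ L G is f (w ∨ i) − Δ L G is f w
            ≈⟨ //-cong₂ (Δ-independent jis′ (independent-shift jis independent))
                        (Δ-independent jis′ (proj₁ (independent-∷ jis independent))) ⟩
          Σ[ y , (w ∨ i) ∨ y ] − Σ[ y , w ∨ y ]
            ≡⟨ cong (λ r → Σ[ y , r ] − Σ[ y , w ∨ y ]) (∨.xy∙z≈xz∙y w i y) ⟩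
          Σ[ y , x ∨ i ] − Σ[ y , x ]
            ≈⟨ ∙-congʳ (sumInterval-split-cover G m (proj₂ (independent-∷ jis independent)) ji) ⟩
          (Σ[ i ∨ y , x ∨ i ] ∙ Σ[ y , x ]) − Σ[ y , x ]
            ≈⟨ //-rightDividesʳ Σ[ y , x ] Σ[ i ∨ y , x ∨ i ] ⟩
          Σ[ i ∨ y , x ∨ i ]
            ≡⟨ cong (λ r → Σ[ i ∨ y , r ]) (sym (∨.x∙yz≈xz∙y w i y)) ⟩
          Σ[ i ∨ y , w ∨ (i ∨ y) ] ∎
          where
          y x : Carrier
          y = ⋁ L is
          x = w ∨ y
          Σ[_,_] : Carrier → Carrier → AbelianGroup.Carrier G
          Σ[ u , v ] = sumInterval L G m u v

theorem2 : {c ℓ : Level} (L : FiniteLattice) (G : AbelianGroup c ℓ) →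
           LowerLocallyDistributive L →
           (f m : FiniteLattice.Carrier L → AbelianGroup.Carrier G) →
           IsMoebius L G f m →
           (x y : FiniteLattice.Carrier L) (is : List (FiniteLattice.Carrier L)) →
           MinimalDecomposition L y is →
           IntervalBoolean L x (FiniteLattice._∨_ L x y) (length is) →
           AbelianGroup._≈_ G (Δ L G is f x)
             (sumInterval L G m y (FiniteLattice._∨_ L x y))
theorem2 L G lld f m moebius x y is (joinIrreducibles , _ , ⋁is≡y , _) B =
  subst (λ y → AbelianGroup._≈_ G (Δ L G is f x) (sumInterval L G m y (x ∨ y))) ⋁is≡y
    (Δ-independent B G f m moebius joinIrreducibles
      (Subset.⊥ , Subset.⊤ , φ-⊥ , trans φ-⊤ (cong (x ∨_) (sym ⋁is≡y)) , k+∣⊥∣≡∣⊤∣))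
  where
  open FiniteLattice L
  open FiniteLatticeProperties L
  open LowerLocallyDistributiveProperties lld
  open BooleanInterval B
  k+∣⊥∣≡∣⊤∣ : length is ℕ.+ ∣ Subset.⊥ {length is} ∣ ≡ ∣ Subset.⊤ {length is} ∣
  k+∣⊥∣≡∣⊤∣ = trans (cong (length is ℕ.+_) (∣⊥∣≡0 (length is)))
                     (trans (ℕ.+-identityʳ (length is)) (sym (∣⊤∣≡n (length is))))
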